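{- Let $C'$ and $C''$ be two distinct cut-sets of a colored graph $G$. Then there is an open component of $C'$ containing (all edges of) $C''$, and an open component of $C''$ containing (all edges of) $C'$.
   Context: A colored graph (for an integer $D\ge3$) is a finite connected bipartite multigraph (black/white vertices, multiple edges allowed) with edges colored in $\{0,\dots,D\}$, every vertex incident to exactly one edge of each color. A 2-edge-cut of $G=(X,E)$ is a pair of edges whose removal disconnects $G$. A proper cut-set is a set of edges, maximal for inclusion, any two of which form a 2-edge-cut; the cut-set of an edge $e$ is the proper cut-set containing it if any, and $\{e\}$ otherwise; a cut-set is the cut-set of some edge. For a cut-set $C$ there is a unique cyclic arrangement $(e_0,\dots,e_\ell)$ of its edges and a unique partition $X_0,\dots,X_\ell$ of $X$ such that $E$ is the union of $C$ and the sets $E_{X_i}$ of edges with both endpoints in $X_i$, and $e_i$ joins a black vertex of $X_i$ to a white vertex of $X_{i+1}$ (indices mod $\ell+1$). The open components of $C$ are the structures $G_0,\dots,G_\ell$ obtained by cutting each edge of $C$ into its two half-edges: $G_i$ has vertex set $X_i$, edge set $E_{X_i}$, and two unmatched half-edges coming from $e_{i-1}$ and $e_i$. An open component contains an edge if that edge belongs to its edge set. -}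

module Defs where

open import Data.Nat using (ℕ; zero; suc; _≤_)
open import Data.Nat.DivMod using (_%_; m%n<n)
open import Data.Fin using (Fin; toℕ; fromℕ<)
open import Data.Fin.Permutation using (Permutation′; _⟨$⟩ʳ_)
open import Data.Product using (Σ; ∃; _×_; _,_; proj₁; proj₂)
open import Data.Sum using (_⊎_; inj₁; inj₂)
open import Data.Empty using (⊥)
open import Relation.Nullary using (¬_)
open import Relation.Binary.PropositionalEquality using (_≡_; _≢_)
open import Relation.Unary using (Pred; _⊆_; _≐_)
open import Level using (0ℓ)

-- Black vertices: Fin m, white vertices: Fin m.  Each color class is a
-- perfect matching, given by a permutation σ c : black → white.
-- The edge of color c at black vertex b joins b to the white vertex σ c b.
-- Multiple edges (same endpoints, different colors) are allowed.
record ColoredGraph (D : ℕ) : Set where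
  field
    m : ℕ
    σ : Fin (suc D) → Permutation′ m

module _ {D : ℕ} (G : ColoredGraph D) where
  open ColoredGraph G

  Vertex : Set
  Vertex = Fin m ⊎ Fin m      -- inj₁ = black, inj₂ = white

  Edge : Set
  Edge = Fin (suc D) × Fin m  -- (color, black endpoint)

  blackEnd : Edge → Vertex
  blackEnd e = inj₁ (proj₂ e)

  whiteEnd : Edge → Vertex
  whiteEnd e = inj₂ (σ (proj₁ e) ⟨$⟩ʳ proj₂ e)

  EdgeSet : Set₁
  EdgeSet = Pred Edge 0ℓ

  data Reach (S : EdgeSet) : Vertex → Vertex → Set where
    here : ∀ {x} → Reach S x x
    stepBW : ∀ {y} (e : Edge) → ¬ S e → Reach S (whiteEnd e) y → Reach S (blackEnd e) y
    stepWB : ∀ {y} (e : Edge) → ¬ S e → Reach S (blackEnd e) y → Reach S (whiteEnd e) y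

  ConnectedWithout : EdgeSet → Set
  ConnectedWithout S = ∀ x y → Reach S x y

  Connected : Set
  Connected = ConnectedWithout (λ _ → ⊥)

  TwoEdgeCut : Edge → Edge → Set
  TwoEdgeCut e f = e ≢ f × ¬ ConnectedWithout (λ g → g ≡ e ⊎ g ≡ f)

  PairwiseCut : EdgeSet → Set
  PairwiseCut C = ∀ e f → C e → C f → e ≢ f → TwoEdgeCut e f

  ProperCutSet : EdgeSet → Set₁
  ProperCutSet C = PairwiseCut C × (∀ (C′ : EdgeSet) → C ⊆ C′ → PairwiseCut C′ → C′ ⊆ C)

  CutSetOf : Edge → EdgeSet → Set₁
  CutSetOf e C =
    (ProperCutSet C × C e)
    ⊎ ((¬ Σ EdgeSet (λ C′ → ProperCutSet C′ × C′ e)) × (C ≐ (λ g → g ≡ e)))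

  IsCutSet : EdgeSet → Set₁
  IsCutSet C = Σ Edge (λ e → CutSetOf e C)

  next : ∀ {ℓ} → Fin (suc ℓ) → Fin (suc ℓ)
  next {ℓ} i = fromℕ< (m%n<n (suc (toℕ i)) (suc ℓ))

  -- cyclic arrangement (e₀,…,e_ℓ) of C together with partition X₀,…,X_ℓ of the
  -- vertices (X v = index of the part containing v)
  record Arrangement (C : EdgeSet) : Set where
    field
      ℓ : ℕ
      edge : Fin (suc ℓ) → Edge
      edge-inj : ∀ i j → edge i ≡ edge j → i ≡ j
      edge-in : ∀ i → C (edge i)
      edge-onto : ∀ f → C f → ∃ (λ i → edge i ≡ f)
      part : Vertex → Fin (suc ℓ)
      cover : ∀ f → C f ⊎ ∃ (λ i → part (blackEnd f) ≡ i × part (whiteEnd f) ≡ i)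
      ends : ∀ i → part (blackEnd (edge i)) ≡ i × part (whiteEnd (edge i)) ≡ next i

  -- the open component G_i of the arrangement A contains the edge f,
  -- i.e. f belongs to E_{X_i}
  ComponentContains : ∀ {C} → (A : Arrangement C) → Fin (suc (Arrangement.ℓ A)) → Edge → Set
  ComponentContains A i f = part (blackEnd f) ≡ i × part (whiteEnd f) ≡ i
    where open Arrangement A

-- A colored graph with at least two colors has no bridge: from the black end of an edge e of color c,
-- alternately following another color and c traces the orbit of a permutation, which must come back
-- through e.  In a bridgeless graph, 2-edge-cuts are transitive on distinct edges, so the union of two
-- pairwise-cut sets sharing an edge is pairwise-cut; hence distinct cut-sets are disjoint.
-- Now let f, g ∈ C″ lie in parts X_i ≠ X_j of C′.  By maximality of C′, neither f nor g forms a 2-edge-cut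
-- with any e_k ∈ C′.  Removing e_k together with the one of f, g that is not inside X_k, every vertex of X_k
-- still walks out of X_k, and the only way out avoiding e_k is e_(k-1).  Chaining these walks connects
-- G − {f, g}, contradicting that {f, g} is a 2-edge-cut.
module Submission where

open import Defs
open import Data.Nat using (ℕ; zero; suc; _≤_; _∸_; s≤s; z≤n)
open import Data.Nat.Properties using (≤-trans; n<1+n; +-suc; m+[n∸m]≡n; m≤n⇒m<n∨m≡n; 1+n≢n; 0≢1+n; <⇒≢; suc-injective)
open import Data.Nat.DivMod using (_%_; m<n⇒m%n≡m; n%n≡0)
open import Data.Nat.GeneralisedArithmetic using (fold; fold-+)
open import Data.Fin using (Fin; toℕ; fromℕ) renaming (zero to fzero; suc to fsuc)
open import Data.Fin.Properties using (pigeonhole; sequence; toℕ≤pred[n]; toℕ-fromℕ<; toℕ-fromℕ; toℕ-injective) renaming (_≟_ to _≟ᶠ_)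
open import Data.Fin.Permutation using (_⟨$⟩ʳ_; inverseʳ; flip; _∘ₚ_)
open import Data.Product using (∃; ∃₂; _×_; _,_; proj₁; proj₂; map₂)
open import Data.Product.Properties using (≡-dec)
open import Data.Sum using (_⊎_; inj₁; inj₂; [_,_]; [_,_]′)
import Data.Sum as Sum
open import Data.Empty using (⊥-elim)
open import Function using (_∘_; _$_; id)
open import Function.Bundles using (Injection)
open import Function.Definitions using (Injective)
open import Function.Properties.Inverse using (↔⇒↣)
open import Relation.Nullary using (¬_; yes; no)
open import Relation.Nullary.Negation using (¬¬-Monad)
open import Effect.Monad using (RawMonad)
open import Relation.Binary.Definitions using (DecidableEquality)
open import Relation.Binary.PropositionalEquality using (_≡_; _≢_; refl; sym; trans; cong; subst)
open import Relation.Unary using (Satisfiable; _⊆_; _≐_; _∪_)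
open import Relation.Unary.Properties using (≐-sym; ≐-trans)

fold-injective : ∀ {A : Set} {f : A → A} → Injective _≡_ _≡_ f →
  ∀ n {x y} → fold x f n ≡ fold y f n → x ≡ y
fold-injective f-inj zero    eq = eq
fold-injective f-inj (suc n) eq = fold-injective f-inj n (f-inj eq)

orbit-returns : ∀ {m} (f : Fin m → Fin m) → Injective _≡_ _≡_ f →
  ∀ x → ∃ λ n → fold x f (suc n) ≡ x
orbit-returns {m} f f-inj x
  with i , j , i<j , orbitᵢ≡orbitⱼ ← pigeonhole (n<1+n m) (λ k → fold x f (toℕ k))
  = gap , sym (fold-injective f-inj (toℕ i) (trans orbitᵢ≡orbitⱼ j≡i+gap))
  where
  gap = toℕ j ∸ suc (toℕ i)
  j≡i+gap : fold x f (toℕ j) ≡ fold (fold x f (suc gap)) f (toℕ i)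
  j≡i+gap = trans (cong (fold x f) (sym (trans (+-suc (toℕ i) gap) (m+[n∸m]≡n i<j))))
                  (fold-+ x f (toℕ i))

¬¬-sequence : ∀ {n} {P : Fin n → Set} → (∀ k → ¬ ¬ P k) → ¬ ¬ (∀ k → P k)
¬¬-sequence = sequence (RawMonad.rawApplicative ¬¬-Monad)

distinct⇒1≤ℓ : ∀ {ℓ} {i j : Fin (suc ℓ)} → i ≢ j → 1 ≤ ℓ
distinct⇒1≤ℓ {zero}  {fzero} {fzero} i≢j = ⊥-elim (i≢j refl)
distinct⇒1≤ℓ {suc _} _ = s≤s z≤n

otherColour : ∀ {D} → 1 ≤ D → (c : Fin (suc D)) → ∃ λ c′ → c′ ≢ c
otherColour (s≤s _) fzero    = fsuc fzero , λ ()
otherColour (s≤s _) (fsuc _) = fzero , λ ()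

module _ {D : ℕ} (G : ColoredGraph D) where
  open ColoredGraph G

  ｛_｝ₑ : Edge G → EdgeSet G
  ｛ e ｝ₑ g = g ≡ e

  _≟ₑ_ : DecidableEquality (Edge G)
  _≟ₑ_ = ≡-dec _≟ᶠ_ _≟ᶠ_

  Reach-trans : ∀ {S x y z} → Reach G S x y → Reach G S y z → Reach G S x z
  Reach-trans here           q = q
  Reach-trans (stepBW e e∉S p) q = stepBW e e∉S (Reach-trans p q)
  Reach-trans (stepWB e e∉S p) q = stepWB e e∉S (Reach-trans p q)

  Reach-sym : ∀ {S x y} → Reach G S x y → Reach G S y x
  Reach-sym here             = here
  Reach-sym (stepBW e e∉S p) = Reach-trans (Reach-sym p) (stepWB e e∉S here)
  Reach-sym (stepWB e e∉S p) = Reach-trans (Reach-sym p) (stepBW e e∉S here)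

  Reach-antimono : ∀ {S S′ x y} → S ⊆ S′ → Reach G S′ x y → Reach G S x y
  Reach-antimono S⊆S′ here             = here
  Reach-antimono S⊆S′ (stepBW e e∉S p) = stepBW e (e∉S ∘ S⊆S′) (Reach-antimono S⊆S′ p)
  Reach-antimono S⊆S′ (stepWB e e∉S p) = stepWB e (e∉S ∘ S⊆S′) (Reach-antimono S⊆S′ p)

  ConnectedWithout-antimono : ∀ {S S′} → S ⊆ S′ → ConnectedWithout G S′ → ConnectedWithout G S
  ConnectedWithout-antimono S⊆S′ conn x y = Reach-antimono S⊆S′ (conn x y)

  data End (h : Edge G) : Vertex G → Set where
    black : End h (blackEnd G h)
    white : End h (whiteEnd G h)

  firstUse : ∀ {S x y} h → Reach G S x y →
    Reach G (S ∪ ｛ h ｝ₑ) x y ⊎ ∃ λ u → End h u × Reach G (S ∪ ｛ h ｝ₑ) x u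
  firstUse h here = inj₁ here
  firstUse h (stepBW e e∉S p) with e ≟ₑ h
  ... | yes refl = inj₂ (_ , black , here)
  ... | no e≢h   = Sum.map (stepBW e [ e∉S , e≢h ]) (map₂ (map₂ (stepBW e [ e∉S , e≢h ]))) (firstUse h p)
  firstUse h (stepWB e e∉S p) with e ≟ₑ h
  ... | yes refl = inj₂ (_ , white , here)
  ... | no e≢h   = Sum.map (stepWB e [ e∉S , e≢h ]) (map₂ (map₂ (stepWB e [ e∉S , e≢h ]))) (firstUse h p)

  lastUse : ∀ {S x y} h → Reach G S x y →
    Reach G (S ∪ ｛ h ｝ₑ) x y ⊎ ∃ λ v → End h v × Reach G (S ∪ ｛ h ｝ₑ) v y
  lastUse h p = Sum.map Reach-sym (map₂ (map₂ Reach-sym)) (firstUse h (Reach-sym p))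

  Crossing : EdgeSet G → Edge G → Vertex G → Vertex G → Set
  Crossing S h x y =
    (Reach G S x (blackEnd G h) × Reach G S (whiteEnd G h) y) ⊎
    (Reach G S x (whiteEnd G h) × Reach G S (blackEnd G h) y)

  -- If the first and the last use of h touch the same end of h, the stretch in between can be cut out.
  avoid-or-cross : ∀ {S x y} h → Reach G S x y →
    Reach G (S ∪ ｛ h ｝ₑ) x y ⊎ Crossing (S ∪ ｛ h ｝ₑ) h x y
  avoid-or-cross h p with firstUse h p | lastUse h p
  ... | inj₁ q                 | _                      = inj₁ q
  ... | inj₂ _                 | inj₁ q                 = inj₁ q
  ... | inj₂ (_ , black , q)   | inj₂ (_ , black , q′)  = inj₁ (Reach-trans q q′)
  ... | inj₂ (_ , black , q)   | inj₂ (_ , white , q′)  = inj₂ (inj₁ (q , q′))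
  ... | inj₂ (_ , white , q)   | inj₂ (_ , black , q′)  = inj₂ (inj₂ (q , q′))
  ... | inj₂ (_ , white , q)   | inj₂ (_ , white , q′)  = inj₁ (Reach-trans q q′)

  ConnectedWithout-extend : ∀ {S e} → ConnectedWithout G S →
    Reach G (S ∪ ｛ e ｝ₑ) (blackEnd G e) (whiteEnd G e) → ConnectedWithout G (S ∪ ｛ e ｝ₑ)
  ConnectedWithout-extend {S} {e} conn ends x y = Reach-trans (toBlack x) (Reach-sym (toBlack y))
    where
    toBlack : ∀ z → Reach G (S ∪ ｛ e ｝ₑ) z (blackEnd G e)
    toBlack z with firstUse e (conn z (blackEnd G e))
    ... | inj₁ p               = p
    ... | inj₂ (_ , black , p) = p
    ... | inj₂ (_ , white , p) = Reach-trans p (Reach-sym ends)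

  -- τ b is reached from b along its c′-edge and then a c-edge.  The τ-orbit of b₀ returns to b₀, so
  -- following it from the black end of e = (c , b₀) arrives at the white end of e, the first time the
  -- next c-edge would be e itself.
  ends-connected-without : 1 ≤ D → ∀ e → Reach G ｛ e ｝ₑ (blackEnd G e) (whiteEnd G e)
  ends-connected-without 1≤D e@(c , b₀) = [ arrive returns , id ]′ (orbit n)
    where
    c′ = proj₁ (otherColour 1≤D c)
    τ = (σ c′ ∘ₚ flip (σ c)) ⟨$⟩ʳ_
    τ-injective = Injection.injective (↔⇒↣ (σ c′ ∘ₚ flip (σ c)))
    n = proj₁ (orbit-returns τ τ-injective b₀)

    returns : τ (fold b₀ τ n) ≡ b₀
    returns = proj₂ (orbit-returns τ τ-injective b₀)

    R = Reach G ｛ e ｝ₑ (inj₁ b₀)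

    toWhite : ∀ {b} → R (inj₁ b) → R (whiteEnd G (c , τ b))
    toWhite {b} p = subst R (cong inj₂ (sym (inverseʳ (σ c))))
                          (Reach-trans p (stepBW (c′ , b) (proj₂ (otherColour 1≤D c) ∘ cong proj₁) here))

    arrive : ∀ {b} → τ b ≡ b₀ → R (inj₁ b) → R (whiteEnd G e)
    arrive τb≡b₀ p = subst R (cong (λ b → whiteEnd G (c , b)) τb≡b₀) (toWhite p)

    step : ∀ {b} → R (inj₁ b) → R (inj₁ (τ b)) ⊎ R (whiteEnd G e)
    step {b} p with τ b ≟ᶠ b₀
    ... | yes τb≡b₀ = inj₂ (arrive τb≡b₀ p)
    ... | no τb≢b₀  = inj₁ (Reach-trans (toWhite p) (stepWB (c , τ b) (τb≢b₀ ∘ cong proj₂) here))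

    orbit : ∀ k → R (inj₁ (fold b₀ τ k)) ⊎ R (whiteEnd G e)
    orbit zero    = inj₁ here
    orbit (suc k) = [ step , inj₂ ]′ (orbit k)

  bridgeless : 1 ≤ D → Connected G → ∀ e → ConnectedWithout G ｛ e ｝ₑ
  bridgeless 1≤D conn e =
    ConnectedWithout-antimono inj₂
      (ConnectedWithout-extend conn (Reach-antimono [ ⊥-elim , id ] (ends-connected-without 1≤D e)))

  TwoEdgeCut-sym : ∀ {e f} → TwoEdgeCut G e f → TwoEdgeCut G f e
  TwoEdgeCut-sym (e≢f , disconnected) = e≢f ∘ sym , disconnected ∘ ConnectedWithout-antimono Sum.swap

  TwoEdgeCut⇒PairwiseCut : ∀ {e f} → TwoEdgeCut G e f → PairwiseCut G (｛ e ｝ₑ ∪ ｛ f ｝ₑ)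
  TwoEdgeCut⇒PairwiseCut cut _ _ (inj₁ refl) (inj₁ refl) g≢g = ⊥-elim (g≢g refl)
  TwoEdgeCut⇒PairwiseCut cut _ _ (inj₁ refl) (inj₂ refl) _   = cut
  TwoEdgeCut⇒PairwiseCut cut _ _ (inj₂ refl) (inj₁ refl) _   = TwoEdgeCut-sym cut
  TwoEdgeCut⇒PairwiseCut cut _ _ (inj₂ refl) (inj₂ refl) g≢g = ⊥-elim (g≢g refl)

  IsCutSet⇒Satisfiable : ∀ {C} → IsCutSet G C → Satisfiable C
  IsCutSet⇒Satisfiable (e , inj₁ (_ , Ce))   = e , Ce
  IsCutSet⇒Satisfiable (e , inj₂ (_ , C≐e)) = e , proj₂ C≐e refl

  IsCutSet⇒CutSetOf : ∀ {C h} → IsCutSet G C → C h → CutSetOf G h C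
  IsCutSet⇒CutSetOf (_ , inj₁ (proper , _)) Ch = inj₁ (proper , Ch)
  IsCutSet⇒CutSetOf {C} (_ , inj₂ (noProper , C≐e)) Ch =
    subst (λ e → CutSetOf G e C) (sym (proj₁ C≐e Ch)) (inj₂ (noProper , C≐e))

  IsCutSet⇒PairwiseCut : ∀ {C} → IsCutSet G C → PairwiseCut G C
  IsCutSet⇒PairwiseCut (_ , inj₁ ((cut , _) , _)) = cut
  IsCutSet⇒PairwiseCut (_ , inj₂ (_ , C≐e)) _ _ Ce Cf e≢f =
    ⊥-elim (e≢f (trans (proj₁ C≐e Ce) (sym (proj₁ C≐e Cf))))

  IsCutSet⇒ProperCutSet : ∀ {C e f} → IsCutSet G C → C e → C f → e ≢ f → ProperCutSet G C
  IsCutSet⇒ProperCutSet (_ , inj₁ (proper , _)) _  _  _   = proper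
  IsCutSet⇒ProperCutSet (_ , inj₂ (_ , C≐e))   Ce Cf e≢f =
    ⊥-elim (e≢f (trans (proj₁ C≐e Ce) (sym (proj₁ C≐e Cf))))

  toℕ-next : ∀ {ℓ} (t : Fin (suc ℓ)) →
    toℕ (next G t) ≡ suc (toℕ t) ⊎ (toℕ (next G t) ≡ 0 × toℕ t ≡ ℓ)
  toℕ-next {ℓ} t with m≤n⇒m<n∨m≡n (toℕ≤pred[n] t)
  ... | inj₁ t<ℓ = inj₁ (trans (toℕ-fromℕ< _) (m<n⇒m%n≡m (s≤s t<ℓ)))
  ... | inj₂ t≡ℓ = inj₂ (trans (toℕ-fromℕ< _) (trans (cong (λ n → suc n % suc ℓ) t≡ℓ) (n%n≡0 (suc ℓ))) , t≡ℓ)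

  next-≢ : ∀ {ℓ} → 1 ≤ ℓ → (t : Fin (suc ℓ)) → next G t ≢ t
  next-≢ 1≤ℓ t next≡t with toℕ-next t
  ... | inj₁ next≡1+t      = 1+n≢n (trans (sym next≡1+t) (cong toℕ next≡t))
  ... | inj₂ (next≡0 , t≡ℓ) = <⇒≢ 1≤ℓ (trans (sym next≡0) (trans (cong toℕ next≡t) t≡ℓ))

  module _ {C : EdgeSet G} (A : Arrangement G C) where
    open Arrangement A

    outside⇒ComponentContains : ∀ {f} → ¬ C f → ∃ λ i → ComponentContains G A i f
    outside⇒ComponentContains f∉C = [ ⊥-elim ∘ f∉C , id ]′ (cover _)

    Exit : EdgeSet G → EdgeSet G → Fin (suc ℓ) → Vertex G → Set
    Exit S T k w = ∃₂ λ c u → C c × ¬ S c × End c u × part u ≡ k × Reach G T w u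

    Exit-prepend : ∀ {S T k w w′} → (∀ {u} → Reach G T w′ u → Reach G T w u) → Exit S T k w′ → Exit S T k w
    Exit-prepend prepend (c , u , Cc , c∉S , end , pu≡k , p) = c , u , Cc , c∉S , end , pu≡k , prepend p

    exit : ∀ {S T k w y} → (∀ e → ¬ S e → ComponentContains G A k e → ¬ T e) →
      Reach G S w y → part w ≡ k → part y ≢ k → Exit S T k w
    exit inside here pw≡k py≢k = ⊥-elim (py≢k pw≡k)
    exit inside (stepBW e e∉S p) pb≡k py≢k with cover e
    ... | inj₁ Ce = e , _ , Ce , e∉S , black , pb≡k , here
    ... | inj₂ (j , pb≡j , pw≡j) =
      Exit-prepend (stepBW e (inside e e∉S (pb≡k , pw≡k))) (exit inside p pw≡k py≢k)
      where pw≡k = trans pw≡j (trans (sym pb≡j) pb≡k)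
    exit inside (stepWB e e∉S p) pw≡k py≢k with cover e
    ... | inj₁ Ce = e , _ , Ce , e∉S , white , pw≡k , here
    ... | inj₂ (j , pb≡j , pw≡j) =
      Exit-prepend (stepWB e (inside e e∉S (pb≡k , pw≡k))) (exit inside p pb≡k py≢k)
      where pb≡k = trans pb≡j (trans (sym pw≡j) pw≡k)

    reach-incoming : ∀ {S T k w} → 1 ≤ ℓ → ConnectedWithout G S → S (edge k) →
      (∀ e → ¬ S e → ComponentContains G A k e → ¬ T e) → part w ≡ k →
      ∃ λ t → next G t ≡ k × Reach G T w (whiteEnd G (edge t))
    reach-incoming {S} {k = k} {w} 1≤ℓ conn S-edge inside pw≡k
      with exit inside (conn w (whiteEnd G (edge k))) pw≡k (next-≢ 1≤ℓ k ∘ trans (sym (proj₂ (ends k))))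
    ... | c , u , Cc , c∉S , end , pu≡k , p with edge-onto c Cc | end
    ... | t , refl | black = ⊥-elim (c∉S (subst (S ∘ edge) (sym (trans (sym (proj₁ (ends t))) pu≡k)) S-edge))
    ... | t , refl | white = t , trans (sym (proj₂ (ends t))) pu≡k , p

    -- Every vertex is joined to the white end of e_ℓ by descending through the parts X_k, X_(k-1), ….
    ConnectedWithout-pair : ∀ {f g i j} → ¬ C f → ¬ C g →
      ComponentContains G A i f → ComponentContains G A j g → i ≢ j →
      (∀ k → ConnectedWithout G (｛ f ｝ₑ ∪ ｛ edge k ｝ₑ)) →
      (∀ k → ConnectedWithout G (｛ g ｝ₑ ∪ ｛ edge k ｝ₑ)) →
      ConnectedWithout G (｛ f ｝ₑ ∪ ｛ g ｝ₑ)
    ConnectedWithout-pair {f} {g} {i} {j} f∉C g∉C (fb≡i , _) (gb≡j , _) i≢j f-harmless g-harmless x y =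
      Reach-trans (toLast _ x refl) (Reach-sym (toLast _ y refl))
      where
      T = ｛ f ｝ₑ ∪ ｛ g ｝ₑ

      edge∉T : ∀ t → ¬ T (edge t)
      edge∉T t = [ (λ eq → f∉C (subst C eq (edge-in t))) , (λ eq → g∉C (subst C eq (edge-in t))) ]

      leave : ∀ w → ∃ λ t → next G t ≡ part w × Reach G T w (whiteEnd G (edge t))
      leave w with part w ≟ᶠ j
      ... | yes k≡j = reach-incoming (distinct⇒1≤ℓ i≢j) (g-harmless (part w)) (inj₂ refl) inside refl
        where
        inside : ∀ e → ¬ (｛ g ｝ₑ ∪ ｛ edge (part w) ｝ₑ) e → ComponentContains G A (part w) e → ¬ T e
        inside _ _   (eb≡k , _) (inj₁ refl) = i≢j (trans (sym fb≡i) (trans eb≡k k≡j))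
        inside _ e∉S _          (inj₂ refl) = e∉S (inj₁ refl)
      ... | no k≢j = reach-incoming (distinct⇒1≤ℓ i≢j) (f-harmless (part w)) (inj₂ refl) inside refl
        where
        inside : ∀ e → ¬ (｛ f ｝ₑ ∪ ｛ edge (part w) ｝ₑ) e → ComponentContains G A (part w) e → ¬ T e
        inside _ e∉S _          (inj₁ refl) = e∉S (inj₁ refl)
        inside _ _   (eb≡k , _) (inj₂ refl) = k≢j (trans (sym eb≡k) gb≡j)

      toLast : ∀ n w → toℕ (part w) ≡ n → Reach G T w (whiteEnd G (edge (fromℕ ℓ)))
      toLast n w pw≡n with leave w
      ... | t , t→w , p with toℕ-next t
      ... | inj₂ (_ , t≡ℓ) =
        subst (λ t → Reach G T w (whiteEnd G (edge t))) (toℕ-injective (trans t≡ℓ (sym (toℕ-fromℕ ℓ)))) p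
      toLast zero    w pw≡n | t , t→w , p | inj₁ next≡1+t =
        ⊥-elim (0≢1+n (trans (sym pw≡n) (trans (cong toℕ (sym t→w)) next≡1+t)))
      toLast (suc n) w pw≡n | t , t→w , p | inj₁ next≡1+t =
        Reach-trans p (stepWB (edge t) (edge∉T t) (toLast n (blackEnd G (edge t)) pb≡n))
        where
        pb≡n = trans (cong toℕ (proj₁ (ends t)))
                     (suc-injective (trans (sym next≡1+t) (trans (cong toℕ t→w) pw≡n)))

  module _ (1≤D : 1 ≤ D) (conn : Connected G) where

    ends-separated : ∀ {h a} → ¬ ConnectedWithout G (｛ h ｝ₑ ∪ ｛ a ｝ₑ) →
      ¬ Reach G (｛ h ｝ₑ ∪ ｛ a ｝ₑ) (blackEnd G a) (whiteEnd G a)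
    ends-separated disconnected = disconnected ∘ ConnectedWithout-extend (bridgeless 1≤D conn _)

    -- A walk joining the ends of a in G − {a, b} must cross h, since a is a bridge of G − h;
    -- likewise for b.  Splicing the two crossings around a joins the ends of b in G − {h, b}.
    TwoEdgeCut-trans : ∀ {a h b} → TwoEdgeCut G a h → TwoEdgeCut G h b → a ≢ b → TwoEdgeCut G a b
    TwoEdgeCut-trans {a} {h} {b} (a≢h , ¬conn-ah) (h≢b , ¬conn-hb) a≢b = a≢b , ¬conn-ab
      where
      T = (｛ a ｝ₑ ∪ ｛ b ｝ₑ) ∪ ｛ h ｝ₑ
      R = Reach G T

      a-separated : ¬ Reach G (｛ h ｝ₑ ∪ ｛ a ｝ₑ) (blackEnd G a) (whiteEnd G a)
      a-separated = ends-separated (¬conn-ah ∘ ConnectedWithout-antimono Sum.swap)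

      b-separated : ¬ Reach G (｛ h ｝ₑ ∪ ｛ b ｝ₑ) (blackEnd G b) (whiteEnd G b)
      b-separated = ends-separated ¬conn-hb

      toHB : ∀ {x y} → R x y → Reach G (｛ h ｝ₑ ∪ ｛ b ｝ₑ) x y
      toHB = Reach-antimono [ inj₂ , inj₁ ∘ inj₂ ]

      a∉hb : ¬ (｛ h ｝ₑ ∪ ｛ b ｝ₑ) a
      a∉hb = [ a≢h , a≢b ]

      forward : ∀ {u v} → R (blackEnd G b) u → R (blackEnd G a) u → R v (whiteEnd G a) →
        R v (whiteEnd G b) → Reach G (｛ h ｝ₑ ∪ ｛ b ｝ₑ) (blackEnd G b) (whiteEnd G b)
      forward p₁ q₁ q₂ p₂ =
        Reach-trans (toHB (Reach-trans p₁ (Reach-sym q₁)))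
                    (stepBW a a∉hb (toHB (Reach-trans (Reach-sym q₂) p₂)))

      backward : ∀ {u v} → R (blackEnd G b) v → R v (whiteEnd G a) → R (blackEnd G a) u →
        R u (whiteEnd G b) → Reach G (｛ h ｝ₑ ∪ ｛ b ｝ₑ) (blackEnd G b) (whiteEnd G b)
      backward p₁ q₂ q₁ p₂ =
        Reach-trans (toHB (Reach-trans p₁ q₂)) (stepWB a a∉hb (toHB (Reach-trans q₁ p₂)))

      ¬conn-ab : ¬ ConnectedWithout G (｛ a ｝ₑ ∪ ｛ b ｝ₑ)
      ¬conn-ab conn-ab
        with avoid-or-cross h (conn-ab (blackEnd G a) (whiteEnd G a))
           | avoid-or-cross h (conn-ab (blackEnd G b) (whiteEnd G b))
      ... | inj₁ q | _      = a-separated (Reach-antimono [ inj₂ , inj₁ ∘ inj₁ ] q)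
      ... | _      | inj₁ p = b-separated (toHB p)
      ... | inj₂ (inj₁ (q₁ , q₂)) | inj₂ (inj₁ (p₁ , p₂)) = b-separated (forward p₁ q₁ q₂ p₂)
      ... | inj₂ (inj₁ (q₁ , q₂)) | inj₂ (inj₂ (p₁ , p₂)) = b-separated (backward p₁ q₂ q₁ p₂)
      ... | inj₂ (inj₂ (q₁ , q₂)) | inj₂ (inj₁ (p₁ , p₂)) = b-separated (backward p₁ q₂ q₁ p₂)
      ... | inj₂ (inj₂ (q₁ , q₂)) | inj₂ (inj₂ (p₁ , p₂)) = b-separated (forward p₁ q₁ q₂ p₂)

    PairwiseCut-across : ∀ {A B h e f} → PairwiseCut G A → PairwiseCut G B → A h → B h →
      A e → B f → e ≢ f → TwoEdgeCut G e f
    PairwiseCut-across {h = h} {e} {f} cutA cutB Ah Bh Ae Bf e≢f with e ≟ₑ h | f ≟ₑ h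
    ... | yes refl | _        = cutB e f Bh Bf e≢f
    ... | no _     | yes refl = cutA e f Ae Ah e≢f
    ... | no e≢h   | no f≢h   = TwoEdgeCut-trans (cutA e h Ae Ah e≢h) (cutB h f Bh Bf (f≢h ∘ sym)) e≢f

    PairwiseCut-∪ : ∀ {A B h} → PairwiseCut G A → PairwiseCut G B → A h → B h → PairwiseCut G (A ∪ B)
    PairwiseCut-∪ cutA cutB Ah Bh e f (inj₁ Ae) (inj₁ Af) e≢f = cutA e f Ae Af e≢f
    PairwiseCut-∪ cutA cutB Ah Bh e f (inj₂ Be) (inj₂ Bf) e≢f = cutB e f Be Bf e≢f
    PairwiseCut-∪ cutA cutB Ah Bh e f (inj₁ Ae) (inj₂ Bf) e≢f =
      PairwiseCut-across cutA cutB Ah Bh Ae Bf e≢f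
    PairwiseCut-∪ cutA cutB Ah Bh e f (inj₂ Be) (inj₁ Af) e≢f =
      TwoEdgeCut-sym (PairwiseCut-across cutA cutB Ah Bh Af Be (e≢f ∘ sym))

    ProperCutSet-overlap-⊆ : ∀ {C C′ h} → ProperCutSet G C → ProperCutSet G C′ → C h → C′ h → C ⊆ C′
    ProperCutSet-overlap-⊆ {C} {C′} (cut , _) (cut′ , maximal′) Ch C′h Ce =
      maximal′ (C′ ∪ C) inj₁ (PairwiseCut-∪ cut′ cut C′h Ch) (inj₂ Ce)

    CutSetOf-unique : ∀ {h C C′} → CutSetOf G h C → CutSetOf G h C′ → C ≐ C′
    CutSetOf-unique (inj₁ (P , Ch)) (inj₁ (P′ , C′h)) =
      ProperCutSet-overlap-⊆ P P′ Ch C′h , ProperCutSet-overlap-⊆ P′ P C′h Ch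
    CutSetOf-unique (inj₁ proper)          (inj₂ (noProper , _)) = ⊥-elim (noProper (_ , proper))
    CutSetOf-unique (inj₂ (noProper , _))  (inj₁ proper)         = ⊥-elim (noProper (_ , proper))
    CutSetOf-unique (inj₂ (_ , C≐h))       (inj₂ (_ , C′≐h))     = ≐-trans C≐h (≐-sym C′≐h)

    distinct-cutSets-disjoint : ∀ {C C′ h} → IsCutSet G C → IsCutSet G C′ → ¬ (C ≐ C′) → C h → ¬ C′ h
    distinct-cutSets-disjoint csC csC′ C≢C′ Ch C′h =
      C≢C′ (CutSetOf-unique (IsCutSet⇒CutSetOf csC Ch) (IsCutSet⇒CutSetOf csC′ C′h))

    ProperCutSet-maximal : ∀ {C c h} → ProperCutSet G C → C c → ¬ C h → ¬ TwoEdgeCut G h c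
    ProperCutSet-maximal {C} (cut , maximal) Cc h∉C hc-cut =
      h∉C (maximal _ inj₁ (PairwiseCut-∪ cut (TwoEdgeCut⇒PairwiseCut hc-cut) Cc (inj₂ refl)) (inj₂ (inj₁ refl)))

    cutSet-edges-same-component : ∀ {C′ C″} → IsCutSet G C′ → IsCutSet G C″ → ¬ (C′ ≐ C″) →
      (A : Arrangement G C′) → ∀ {f g i j} → C″ f → C″ g →
      ComponentContains G A i f → ComponentContains G A j g → i ≡ j
    cutSet-edges-same-component {C′} {C″} cs′ cs″ C′≢C″ A {f} {g} {i} {j} C″f C″g f∈i g∈j
      with i ≟ᶠ j
    ... | yes i≡j = i≡j
    ... | no i≢j = ⊥-elim $
      ¬¬-sequence (harmless C″f) λ f-harmless → ¬¬-sequence (harmless C″g) λ g-harmless →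
        proj₂ (IsCutSet⇒PairwiseCut cs″ f g C″f C″g f≢g)
              (ConnectedWithout-pair A (∉C′ C″f) (∉C′ C″g) f∈i g∈j i≢j f-harmless g-harmless)
      where
      open Arrangement A

      ∉C′ : ∀ {h} → C″ h → ¬ C′ h
      ∉C′ C″h C′h = distinct-cutSets-disjoint cs′ cs″ C′≢C″ C′h C″h

      proper : ProperCutSet G C′
      proper = IsCutSet⇒ProperCutSet cs′ (edge-in fzero) (edge-in (next G fzero))
                 (next-≢ (distinct⇒1≤ℓ i≢j) fzero ∘ sym ∘ edge-inj _ _)

      harmless : ∀ {h} → C″ h → ∀ k → ¬ ¬ ConnectedWithout G (｛ h ｝ₑ ∪ ｛ edge k ｝ₑ)
      harmless C″h k disconnected =
        ProperCutSet-maximal proper (edge-in k) (∉C′ C″h)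
          ((λ { refl → ∉C′ C″h (edge-in k) }) , disconnected)

      f≢g : f ≢ g
      f≢g refl = i≢j (trans (sym (proj₁ f∈i)) (proj₁ g∈j))

    cutSet-within-component : ∀ {C′ C″} → IsCutSet G C′ → IsCutSet G C″ → ¬ (C′ ≐ C″) →
      (A : Arrangement G C′) → ∃ λ i → ∀ f → C″ f → ComponentContains G A i f
    cutSet-within-component {C′} {C″} cs′ cs″ C′≢C″ A = i₀ , contained
      where
      ∉C′ : ∀ {h} → C″ h → ¬ C′ h
      ∉C′ C″h C′h = distinct-cutSets-disjoint cs′ cs″ C′≢C″ C′h C″h

      e₀ = proj₁ (IsCutSet⇒Satisfiable cs″)
      C″e₀ = proj₂ (IsCutSet⇒Satisfiable cs″)
      i₀ = proj₁ (outside⇒ComponentContains A (∉C′ C″e₀))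

      contained : ∀ f → C″ f → ComponentContains G A i₀ f
      contained f C″f with outside⇒ComponentContains A (∉C′ C″f)
      ... | i , f∈i = subst (λ i → ComponentContains G A i f)
        (cutSet-edges-same-component cs′ cs″ C′≢C″ A C″f C″e₀ f∈i
          (proj₂ (outside⇒ComponentContains A (∉C′ C″e₀)))) f∈i

lemma5 : ∀ {D : ℕ} → 3 ≤ D → (G : ColoredGraph D) → Connected G →
    (C′ C″ : EdgeSet G) → IsCutSet G C′ → IsCutSet G C″ → ¬ (C′ ≐ C″) →
    ((A : Arrangement G C′) → ∃ (λ i → ∀ f → C″ f → ComponentContains G A i f))
    × ((A : Arrangement G C″) → ∃ (λ i → ∀ f → C′ f → ComponentContains G A i f))
lemma5 3≤D G conn C′ C″ cs′ cs″ C′≢C″ =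
  cutSet-within-component G 1≤D conn cs′ cs″ C′≢C″ ,
  cutSet-within-component G 1≤D conn cs″ cs′ (C′≢C″ ∘ ≐-sym)
  where
  1≤D = ≤-trans (s≤s z≤n) 3≤D
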